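{- For integers $i,j$ define integers $a_{i,j}(n)$, $n\ge0$, by $a_{i,j}(0)=0$ for all $i,j$; $a_{i,j}(1)=1$ if $i=j=1$ and $a_{i,j}(1)=0$ otherwise; and for $n\ge 0$ \[ a_{i,j}(n+2)=a_{i,j}(n+1)+a_{i-1,j}(n+1)+a_{i,j-1}(n+1)+a_{i-1,j-1}(n+1)+a_{i-1,j-1}(n). \] Then for every positive integer $m$, \[ P_{m,m}=\{(i,j)\in\mathbb{Z}^2 : a_{i,j}(m)\equiv 1 \pmod 2\}. \]
   Context: For a positive integer $m$, the chocolate game $C_{m,m}$ is a two-player impartial game on an $m\times m$ chocolate bar of unit cells, exactly one of which is poisoned (known to both players); cells are $(i,j)\in\mathbb{Z}^2$ with $1\le i,j\le m$. Players alternately break the current bar along a grid line into two rectangular pieces, eat one and pass the other (always keeping the poisoned cell); a player who receives the $1\times1$ bar loses. A cell is a P-position if with poison there the second player has a winning strategy; $P_{m,m}$ is the set of P-positions. It is known that $(i,j)\in P_{m,m}$ iff $1\le i,j\le m$ and $(i-1)\oplus(j-1)\oplus(m-i)\oplus(m-j)=0$ ($\oplus$ = bitwise XOR). -}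

module Defs where

open import Data.Integer using (ℤ; +_; _+_; _-_; _≤_; _<_)
open import Data.Nat using (ℕ; zero; suc)
open import Data.Bool using (if_then_else_; _∧_)
open import Data.Integer using (_≟_)
open import Relation.Nullary.Decidable using (⌊_⌋)
open import Data.Product using (Σ; _×_)

-- The chocolate game.
-- A bar is the integer rectangle [x₁,x₂] × [y₁,y₂] of unit cells
-- (cells (x,y) with x₁ ≤ x ≤ x₂, y₁ ≤ y ≤ y₂).  The poisoned cell
-- (p , q) is fixed for the whole game.

record Bar : Set where
  constructor bar
  field
    x₁ x₂ y₁ y₂ : ℤ

-- A legal move with poison at (p , q): break along a grid line, eat the
-- piece not containing the poison, pass the piece containing it.
data Move (p q : ℤ) : Bar → Bar → Set where
  cut-left  : ∀ {x₁ x₂ y₁ y₂ x₁'} → x₁ < x₁' → x₁' ≤ p →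
              Move p q (bar x₁ x₂ y₁ y₂) (bar x₁' x₂ y₁ y₂)
  cut-right : ∀ {x₁ x₂ y₁ y₂ x₂'} → x₂' < x₂ → p ≤ x₂' →
              Move p q (bar x₁ x₂ y₁ y₂) (bar x₁ x₂' y₁ y₂)
  cut-down  : ∀ {x₁ x₂ y₁ y₂ y₁'} → y₁ < y₁' → y₁' ≤ q →
              Move p q (bar x₁ x₂ y₁ y₂) (bar x₁ x₂ y₁' y₂)
  cut-up    : ∀ {x₁ x₂ y₁ y₂ y₂'} → y₂' < y₂ → q ≤ y₂' →
              Move p q (bar x₁ x₂ y₁ y₂) (bar x₁ x₂ y₁ y₂')

-- Outcome classes (normal play: the player to move with no legal move,
-- i.e. who receives the 1×1 bar consisting of the poisoned cell, loses).
data PPos (p q : ℤ) (b : Bar) : Set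
data NPos (p q : ℤ) (b : Bar) : Set

data PPos p q b where
  ppos : (∀ {b'} → Move p q b b' → NPos p q b') → PPos p q b

data NPos p q b where
  npos : ∀ {b'} → Move p q b b' → PPos p q b' → NPos p q b

_∈P[_] : ℤ × ℤ → ℕ → Set
(i Data.Product., j) ∈P[ m ] =
  ((+ 1 ≤ i) × (i ≤ + m) × (+ 1 ≤ j) × (j ≤ + m))
  × PPos i j (bar (+ 1) (+ m) (+ 1) (+ m))

a : ℤ → ℤ → ℕ → ℤ
a i j zero = + 0
a i j (suc zero) = if ⌊ i ≟ + 1 ⌋ ∧ ⌊ j ≟ + 1 ⌋ then + 1 else + 0
a i j (suc (suc n)) =
  a i j (suc n) + a (i - + 1) j (suc n) + a i (j - + 1) (suc n)
  + a (i - + 1) (j - + 1) (suc n) + a (i - + 1) (j - + 1) n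

-- A cut never changes the poisoned cell (p, q) and shortens exactly one of the four distances
-- from it to the edges of the bar, so the chocolate game is the sum of four Nim heaps, and by
-- Bouton's theorem the m × m bar with poison (i, j) is a P-position iff
-- (i - 1) ⊕ (m - i) ⊕ (j - 1) ⊕ (m - j) = 0.
--
-- Modulo 2, A_n = Σ a_{i,j}(n) x^{i-1} y^{j-1} is a power series over GF(2) with A_0 = 0, A_1 = 1
-- and A_{n+2} = (1 + x)(1 + y) A_{n+1} + xy A_n.  Let L_n be the series with coefficient 1 at
-- x^{i-1} y^{j-1} exactly when (i, j) ∈ P_{n,n}.  Comparing the last binary digits of the four
-- distances gives the doubling rules
--   L_{2k} = (1 + x)(1 + y) L_k(x², y²),   L_{2k+1} = L_{k+1}(x², y²) + xy L_k(x², y²),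
-- and since F ↦ F(x², y²) is additive and (1 + x)² = 1 + x² in characteristic 2, they imply by
-- strong induction that L_n satisfies the recurrence of A_n; hence A_n = L_n.

module Submission where

open import Defs
open import Data.Nat using (ℕ; NonZero)
open import Data.Integer using (ℤ; +_; _%_)
open import Data.Product using (_,_)
open import Relation.Binary.PropositionalEquality using (_≡_)
open import Function.Bundles using (_⇔_)

module BinaryDigits where

  open import Data.Bool using (Bool; true; false; not; _xor_)
  open import Data.Nat using (zero; suc; _+_; _∸_; _≤_; _<_; _<ᵇ_; _≡ᵇ_; z≤n; s≤s; ⌊_/2⌋)
  open import Data.Nat.Properties using (≤-pred; ≤-<-trans; ⌊n/2⌋-mono; ⌊n/2⌋<n)
  open import Relation.Binary.PropositionalEquality

  double : ℕ → ℕ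
  double zero    = zero
  double (suc n) = suc (suc (double n))

  infixl 7 _·2+_

  _·2+_ : ℕ → Bool → ℕ
  u ·2+ false = double u
  u ·2+ true  = suc (double u)

  lsb : ℕ → Bool
  lsb zero          = false
  lsb (suc zero)    = true
  lsb (suc (suc n)) = lsb n

  ⌊·2+/2⌋ : ∀ u b → ⌊ u ·2+ b /2⌋ ≡ u
  ⌊·2+/2⌋ zero    false = refl
  ⌊·2+/2⌋ zero    true  = refl
  ⌊·2+/2⌋ (suc u) false = cong suc (⌊·2+/2⌋ u false)
  ⌊·2+/2⌋ (suc u) true  = cong suc (⌊·2+/2⌋ u true)

  lsb-·2+ : ∀ u b → lsb (u ·2+ b) ≡ b
  lsb-·2+ zero    false = refl
  lsb-·2+ zero    true  = refl
  lsb-·2+ (suc u) false = lsb-·2+ u false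
  lsb-·2+ (suc u) true  = lsb-·2+ u true

  ⌊/2⌋·2+lsb : ∀ n → ⌊ n /2⌋ ·2+ lsb n ≡ n
  ⌊/2⌋·2+lsb zero          = refl
  ⌊/2⌋·2+lsb (suc zero)    = refl
  ⌊/2⌋·2+lsb (suc (suc n)) with lsb n | ⌊/2⌋·2+lsb n
  ... | false | eq = cong (λ m → suc (suc m)) eq
  ... | true  | eq = cong (λ m → suc (suc m)) eq

  ⌊/2⌋-≤-pred : ∀ {m f} → m ≤ suc f → ⌊ m /2⌋ ≤ f
  ⌊/2⌋-≤-pred {f = f} m≤1+f = ≤-pred (≤-<-trans (⌊n/2⌋-mono m≤1+f) (⌊n/2⌋<n f))

  lsb-suc : ∀ n → lsb (suc n) ≡ not (lsb n)
  lsb-suc zero          = refl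
  lsb-suc (suc zero)    = refl
  lsb-suc (suc (suc n)) = lsb-suc n

  lsb-+ : ∀ m n → lsb (m + n) ≡ lsb m xor lsb n
  lsb-+ zero          n = refl
  lsb-+ (suc zero)    n = lsb-suc n
  lsb-+ (suc (suc m)) n = lsb-+ m n

  double-∸ : ∀ k u → double k ∸ double u ≡ double (k ∸ u)
  double-∸ k       zero    = refl
  double-∸ zero    (suc u) = refl
  double-∸ (suc k) (suc u) = double-∸ k u

  double-∸-suc : ∀ {u k} b → u < k → double k ∸ suc (u ·2+ b) ≡ (k ∸ suc u) ·2+ not b
  double-∸-suc {zero}  {suc k} false _         = refl
  double-∸-suc {zero}  {suc k} true  _         = refl
  double-∸-suc {suc u} {suc k} false (s≤s u<k) = double-∸-suc false u<k
  double-∸-suc {suc u} {suc k} true  (s≤s u<k) = double-∸-suc true u<k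

  ·2+<ᵇdouble : ∀ u b k → (u ·2+ b <ᵇ double k) ≡ (u <ᵇ k)
  ·2+<ᵇdouble u       b     zero    = refl
  ·2+<ᵇdouble zero    false (suc k) = refl
  ·2+<ᵇdouble zero    true  (suc k) = refl
  ·2+<ᵇdouble (suc u) false (suc k) = ·2+<ᵇdouble u false k
  ·2+<ᵇdouble (suc u) true  (suc k) = ·2+<ᵇdouble u true k

  double<ᵇsuc-double : ∀ u k → (double u <ᵇ suc (double k)) ≡ (u <ᵇ suc k)
  double<ᵇsuc-double zero    k       = refl
  double<ᵇsuc-double (suc u) zero    = refl
  double<ᵇsuc-double (suc u) (suc k) = double<ᵇsuc-double u k

  double≡ᵇdouble : ∀ u v → (double u ≡ᵇ double v) ≡ (u ≡ᵇ v)
  double≡ᵇdouble zero    zero    = refl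
  double≡ᵇdouble zero    (suc v) = refl
  double≡ᵇdouble (suc u) zero    = refl
  double≡ᵇdouble (suc u) (suc v) = double≡ᵇdouble u v

  ·2+≡ᵇ·2+ : ∀ u v b → (u ·2+ b ≡ᵇ v ·2+ b) ≡ (u ≡ᵇ v)
  ·2+≡ᵇ·2+ u v false = double≡ᵇdouble u v
  ·2+≡ᵇ·2+ u v true  = double≡ᵇdouble u v

  ·2+-mono-< : ∀ {u v} b c → u < v → u ·2+ b < v ·2+ c
  ·2+-mono-< {zero}  {suc v} false false _         = s≤s z≤n
  ·2+-mono-< {zero}  {suc v} false true  _         = s≤s z≤n
  ·2+-mono-< {zero}  {suc v} true  false _         = s≤s (s≤s z≤n)
  ·2+-mono-< {zero}  {suc v} true  true  _         = s≤s (s≤s z≤n)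
  ·2+-mono-< {suc u} {suc v} false false (s≤s u<v) = s≤s (s≤s (·2+-mono-< false false u<v))
  ·2+-mono-< {suc u} {suc v} false true  (s≤s u<v) = s≤s (s≤s (·2+-mono-< false true u<v))
  ·2+-mono-< {suc u} {suc v} true  false (s≤s u<v) = s≤s (s≤s (·2+-mono-< true false u<v))
  ·2+-mono-< {suc u} {suc v} true  true  (s≤s u<v) = s≤s (s≤s (·2+-mono-< true true u<v))

open BinaryDigits

module BitwiseXor where

  open import Data.Bool using (Bool; true; false; _xor_)
  open import Data.Bool.Properties using (xor-assoc; xor-same; xor-identityʳ)
  open import Data.Nat using (zero; suc; _+_; _≤_; z≤n; ⌊_/2⌋)
  open import Data.Nat.Properties using (m≤m+n; m≤n+m; m≤n⇒m≤1+n)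
  open import Relation.Binary.PropositionalEquality
  open ≡-Reasoning

  private
    xor-within : ℕ → ℕ → ℕ → ℕ
    xor-within zero    m n = 0
    xor-within (suc f) m n = xor-within f ⌊ m /2⌋ ⌊ n /2⌋ ·2+ (lsb m xor lsb n)

    xor-within-0-0 : ∀ f → xor-within f 0 0 ≡ 0
    xor-within-0-0 zero    = refl
    xor-within-0-0 (suc f) = cong double (xor-within-0-0 f)

    xor-within-irrelevant : ∀ f g {m n} → m ≤ f → n ≤ f → m ≤ g → n ≤ g →
                            xor-within f m n ≡ xor-within g m n
    xor-within-irrelevant zero    zero    _   _   _   _   = refl
    xor-within-irrelevant zero    (suc g) z≤n z≤n _   _   = sym (xor-within-0-0 (suc g))
    xor-within-irrelevant (suc f) zero    _   _   z≤n z≤n = xor-within-0-0 (suc f)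
    xor-within-irrelevant (suc f) (suc g) {m} {n} m≤f n≤f m≤g n≤g =
      cong (_·2+ (lsb m xor lsb n))
           (xor-within-irrelevant f g (⌊/2⌋-≤-pred m≤f) (⌊/2⌋-≤-pred n≤f)
                                      (⌊/2⌋-≤-pred m≤g) (⌊/2⌋-≤-pred n≤g))

  infixl 6 _⊕_

  opaque
    _⊕_ : ℕ → ℕ → ℕ
    m ⊕ n = xor-within (m + n) m n

    ⊕-unfold : ∀ m n → m ⊕ n ≡ (⌊ m /2⌋ ⊕ ⌊ n /2⌋) ·2+ (lsb m xor lsb n)
    ⊕-unfold m n = begin
      xor-within (m + n) m n
        ≡⟨ xor-within-irrelevant (m + n) (suc (m + n)) m≤ n≤ (m≤n⇒m≤1+n m≤) (m≤n⇒m≤1+n n≤) ⟩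
      xor-within (m + n) ⌊ m /2⌋ ⌊ n /2⌋ ·2+ (lsb m xor lsb n)
        ≡⟨ cong (_·2+ (lsb m xor lsb n))
                (xor-within-irrelevant (m + n) (⌊ m /2⌋ + ⌊ n /2⌋)
                   (⌊/2⌋-≤-pred (m≤n⇒m≤1+n m≤)) (⌊/2⌋-≤-pred (m≤n⇒m≤1+n n≤))
                   (m≤m+n _ _) (m≤n+m _ _)) ⟩
      (⌊ m /2⌋ ⊕ ⌊ n /2⌋) ·2+ (lsb m xor lsb n)
        ∎
      where
      m≤ : m ≤ m + n
      m≤ = m≤m+n m n
      n≤ : n ≤ m + n
      n≤ = m≤n+m n m

  lsb-⊕ : ∀ m n → lsb (m ⊕ n) ≡ lsb m xor lsb n
  lsb-⊕ m n = trans (cong lsb (⊕-unfold m n)) (lsb-·2+ (⌊ m /2⌋ ⊕ ⌊ n /2⌋) (lsb m xor lsb n))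

  ⌊⊕/2⌋ : ∀ m n → ⌊ m ⊕ n /2⌋ ≡ ⌊ m /2⌋ ⊕ ⌊ n /2⌋
  ⌊⊕/2⌋ m n = trans (cong ⌊_/2⌋ (⊕-unfold m n)) (⌊·2+/2⌋ (⌊ m /2⌋ ⊕ ⌊ n /2⌋) (lsb m xor lsb n))

  ·2+-⊕-·2+ : ∀ u b v c → (u ·2+ b) ⊕ (v ·2+ c) ≡ (u ⊕ v) ·2+ (b xor c)
  ·2+-⊕-·2+ u b v c = begin
    (u ·2+ b) ⊕ (v ·2+ c)
      ≡⟨ ⊕-unfold (u ·2+ b) (v ·2+ c) ⟩
    (⌊ u ·2+ b /2⌋ ⊕ ⌊ v ·2+ c /2⌋) ·2+ (lsb (u ·2+ b) xor lsb (v ·2+ c))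
      ≡⟨ cong₂ _·2+_ (cong₂ _⊕_ (⌊·2+/2⌋ u b) (⌊·2+/2⌋ v c)) (cong₂ _xor_ (lsb-·2+ u b) (lsb-·2+ v c)) ⟩
    (u ⊕ v) ·2+ (b xor c)
      ∎

  bit : ℕ → ℕ → Bool
  bit zero    n = lsb n
  bit (suc k) n = bit k ⌊ n /2⌋

  bit-0 : ∀ k → bit k 0 ≡ false
  bit-0 zero    = refl
  bit-0 (suc k) = bit-0 k

  bit-⊕ : ∀ k m n → bit k (m ⊕ n) ≡ bit k m xor bit k n
  bit-⊕ zero    m n = lsb-⊕ m n
  bit-⊕ (suc k) m n = trans (cong (bit k) (⌊⊕/2⌋ m n)) (bit-⊕ k ⌊ m /2⌋ ⌊ n /2⌋)

  bit-extensionality : ∀ {m n} → (∀ k → bit k m ≡ bit k n) → m ≡ n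
  bit-extensionality {m} {n} = within (m + n) (m≤m+n m n) (m≤n+m n m)
    where
    within : ∀ f {m n} → m ≤ f → n ≤ f → (∀ k → bit k m ≡ bit k n) → m ≡ n
    within zero    z≤n z≤n _ = refl
    within (suc f) {m} {n} m≤ n≤ same = begin
      m                  ≡⟨ ⌊/2⌋·2+lsb m ⟨
      ⌊ m /2⌋ ·2+ lsb m  ≡⟨ cong₂ _·2+_ (within f (⌊/2⌋-≤-pred m≤) (⌊/2⌋-≤-pred n≤) (λ k → same (suc k)))
                                        (same zero) ⟩
      ⌊ n /2⌋ ·2+ lsb n  ≡⟨ ⌊/2⌋·2+lsb n ⟩
      n                  ∎

  ⊕-identityˡ : ∀ n → 0 ⊕ n ≡ n
  ⊕-identityˡ n = bit-extensionality λ k → trans (bit-⊕ k 0 n) (cong (_xor bit k n) (bit-0 k))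

  ⊕-identityʳ : ∀ n → n ⊕ 0 ≡ n
  ⊕-identityʳ n = bit-extensionality λ k →
    trans (bit-⊕ k n 0) (trans (cong (bit k n xor_) (bit-0 k)) (xor-identityʳ (bit k n)))

  ⊕-self : ∀ n → n ⊕ n ≡ 0
  ⊕-self n = bit-extensionality λ k → trans (bit-⊕ k n n) (trans (xor-same (bit k n)) (sym (bit-0 k)))

  ⊕-assoc : ∀ m n o → m ⊕ n ⊕ o ≡ m ⊕ (n ⊕ o)
  ⊕-assoc m n o = bit-extensionality λ k → begin
    bit k (m ⊕ n ⊕ o)                  ≡⟨ trans (bit-⊕ k (m ⊕ n) o) (cong (_xor bit k o) (bit-⊕ k m n)) ⟩
    (bit k m xor bit k n) xor bit k o  ≡⟨ xor-assoc (bit k m) (bit k n) (bit k o) ⟩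
    bit k m xor (bit k n xor bit k o)  ≡⟨ trans (bit-⊕ k m (n ⊕ o)) (cong (bit k m xor_) (bit-⊕ k n o)) ⟨
    bit k (m ⊕ (n ⊕ o))                ∎

  ⊕≡0⇒≡ : ∀ {m n} → m ⊕ n ≡ 0 → m ≡ n
  ⊕≡0⇒≡ {m} {n} eq = bit-extensionality λ k →
    xor≡false (trans (sym (bit-⊕ k m n)) (trans (cong (bit k) eq) (bit-0 k)))
    where
    xor≡false : ∀ {x y} → x xor y ≡ false → x ≡ y
    xor≡false {false} {false} _ = refl
    xor≡false {true}  {true}  _ = refl

open BitwiseXor

module Nim where

  open import Data.Bool using (true; false; _xor_)
  open import Data.Bool.Solver using (module xor-∧-Solver)
  open import Data.Empty using (⊥-elim)
  open import Data.Fin using (zero; suc)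
  open import Data.Nat using (zero; suc; _<_; _≟_; ⌊_/2⌋)
  open import Data.Nat.Induction using (<-rec)
  open import Data.Nat.Properties using (≤-refl; ⌊n/2⌋<n; <-irrefl; module ≤-Reasoning)
  open import Data.Product using (∃-syntax)
  open import Data.Vec using (Vec; []; _∷_; lookup; map; _[_]≔_)
  open import Data.Vec.Properties using (lookup-map)
  open import Relation.Binary.PropositionalEquality
  open import Relation.Nullary using (yes; no)

  nimSum : ∀ {n} → Vec ℕ n → ℕ
  nimSum []       = 0
  nimSum (h ∷ hs) = h ⊕ nimSum hs

  nimSum-[]≔ : ∀ {n} (hs : Vec ℕ n) i x → nimSum (hs [ i ]≔ x) ≡ nimSum hs ⊕ (lookup hs i ⊕ x)
  nimSum-[]≔ (h ∷ hs) (suc i) x = trans (cong (h ⊕_) (nimSum-[]≔ hs i x)) (sym (⊕-assoc h _ _))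
  nimSum-[]≔ (h ∷ hs) zero    x = bit-extensionality λ k → begin
    bit k (x ⊕ s)                              ≡⟨ bit-⊕ k x s ⟩
    bit k x xor bit k s                        ≡⟨ swap (bit k h) (bit k s) (bit k x) ⟩
    (bit k h xor bit k s) xor (bit k h xor bit k x)
      ≡⟨ trans (bit-⊕ k (h ⊕ s) (h ⊕ x)) (cong₂ _xor_ (bit-⊕ k h s) (bit-⊕ k h x)) ⟨
    bit k (h ⊕ s ⊕ (h ⊕ x))                    ∎
    where
    open ≡-Reasoning
    open xor-∧-Solver
    s : ℕ
    s = nimSum hs
    swap : ∀ h s x → x xor s ≡ (h xor s) xor (h xor x)
    swap = solve 3 (λ h s x → (x :+ s) := (h :+ s) :+ (h :+ x)) refl

  ⌊nimSum/2⌋ : ∀ {n} (hs : Vec ℕ n) → ⌊ nimSum hs /2⌋ ≡ nimSum (map ⌊_/2⌋ hs)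
  ⌊nimSum/2⌋ []       = refl
  ⌊nimSum/2⌋ (h ∷ hs) = trans (⌊⊕/2⌋ h (nimSum hs)) (cong (⌊ h /2⌋ ⊕_) (⌊nimSum/2⌋ hs))

  odd-heap : ∀ {n} (hs : Vec ℕ n) → lsb (nimSum hs) ≡ true → ∃[ i ] lsb (lookup hs i) ≡ true
  odd-heap (h ∷ hs) odd with lsb h in h-parity
  ... | true  = zero , h-parity
  ... | false =
    let i , i-odd = odd-heap hs (trans (cong (_xor lsb (nimSum hs)) (sym h-parity))
                                       (trans (sym (lsb-⊕ h (nimSum hs))) odd))
    in  suc i , i-odd

  -- Bouton: induction on the nim-sum s by halving; once ⌊ s /2⌋ = 0, an odd heap drops by one.
  nimSum≢0⇒lowerable : ∀ {n} (hs : Vec ℕ n) → nimSum hs ≢ 0 →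
                       ∃[ i ] lookup hs i ⊕ nimSum hs < lookup hs i
  nimSum≢0⇒lowerable hs = <-rec Lowerable step (nimSum hs) hs refl
    where
    Lowerable : ℕ → Set
    Lowerable s = ∀ {n} (hs : Vec ℕ n) → nimSum hs ≡ s → s ≢ 0 → ∃[ i ] lookup hs i ⊕ s < lookup hs i

    lower-halves : ∀ {h s} → ⌊ h /2⌋ ⊕ ⌊ s /2⌋ < ⌊ h /2⌋ → h ⊕ s < h
    lower-halves {h} {s} lt = begin-strict
      h ⊕ s                                     ≡⟨ ⊕-unfold h s ⟩
      (⌊ h /2⌋ ⊕ ⌊ s /2⌋) ·2+ (lsb h xor lsb s)  <⟨ ·2+-mono-< (lsb h xor lsb s) (lsb h) lt ⟩
      ⌊ h /2⌋ ·2+ lsb h                          ≡⟨ ⌊/2⌋·2+lsb h ⟩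
      h                                         ∎
      where open ≤-Reasoning

    lower-last-bit : ∀ {h s} → lsb h ≡ true → lsb s ≡ true → ⌊ s /2⌋ ≡ 0 → h ⊕ s < h
    lower-last-bit {h} {s} h-odd s-odd s/2≡0 = begin-strict
      h ⊕ s                                     ≡⟨ ⊕-unfold h s ⟩
      (⌊ h /2⌋ ⊕ ⌊ s /2⌋) ·2+ (lsb h xor lsb s)  ≡⟨ cong₂ _·2+_ (trans (cong (⌊ h /2⌋ ⊕_) s/2≡0)
                                                                       (⊕-identityʳ ⌊ h /2⌋))
                                                                (cong₂ _xor_ h-odd s-odd) ⟩
      ⌊ h /2⌋ ·2+ false                          <⟨ ≤-refl ⟩
      ⌊ h /2⌋ ·2+ true                           ≡⟨ cong (⌊ h /2⌋ ·2+_) h-odd ⟨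
      ⌊ h /2⌋ ·2+ lsb h                          ≡⟨ ⌊/2⌋·2+lsb h ⟩
      h                                         ∎
      where open ≤-Reasoning

    n≢0⇒⌊n/2⌋<n : ∀ n → n ≢ 0 → ⌊ n /2⌋ < n
    n≢0⇒⌊n/2⌋<n zero    n≢0 = ⊥-elim (n≢0 refl)
    n≢0⇒⌊n/2⌋<n (suc n) _   = ⌊n/2⌋<n n

    step : ∀ s → (∀ {t} → t < s → Lowerable t) → Lowerable s
    step s rec hs sum≡s s≢0 with ⌊ s /2⌋ ≟ 0
    ... | no s/2≢0 =
      let i , lt = rec (n≢0⇒⌊n/2⌋<n s s≢0) (map ⌊_/2⌋ hs)
                       (trans (sym (⌊nimSum/2⌋ hs)) (cong ⌊_/2⌋ sum≡s)) s/2≢0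
      in  i , lower-halves (subst (λ h → h ⊕ ⌊ s /2⌋ < h) (lookup-map i ⌊_/2⌋ hs) lt)
    ... | yes s/2≡0 =
      let i , h-odd = odd-heap hs (trans (cong lsb sum≡s) s-odd)
      in  i , lower-last-bit h-odd s-odd s/2≡0
      where
      s-odd : lsb s ≡ true
      s-odd with lsb s in s-parity
      ... | true  = refl
      ... | false = ⊥-elim (s≢0 (trans (sym (⌊/2⌋·2+lsb s)) (cong₂ _·2+_ s/2≡0 s-parity)))

  nimSum-[]≔-≢0 : ∀ {n} (hs : Vec ℕ n) i {x} → nimSum hs ≡ 0 → x < lookup hs i →
                  nimSum (hs [ i ]≔ x) ≢ 0
  nimSum-[]≔-≢0 hs i {x} sum≡0 x<h sum′≡0 = <-irrefl (sym (⊕≡0⇒≡ (begin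
    lookup hs i ⊕ x                ≡⟨ ⊕-identityˡ _ ⟨
    0 ⊕ (lookup hs i ⊕ x)          ≡⟨ cong (_⊕ (lookup hs i ⊕ x)) sum≡0 ⟨
    nimSum hs ⊕ (lookup hs i ⊕ x)  ≡⟨ nimSum-[]≔ hs i x ⟨
    nimSum (hs [ i ]≔ x)           ≡⟨ sum′≡0 ⟩
    0                              ∎))) x<h
    where open ≡-Reasoning

  nimSum-[]≔-⊕nimSum : ∀ {n} (hs : Vec ℕ n) i → nimSum (hs [ i ]≔ (lookup hs i ⊕ nimSum hs)) ≡ 0
  nimSum-[]≔-⊕nimSum hs i = begin
    nimSum (hs [ i ]≔ (h ⊕ s))  ≡⟨ nimSum-[]≔ hs i (h ⊕ s) ⟩
    s ⊕ (h ⊕ (h ⊕ s))           ≡⟨ cong (s ⊕_) (⊕-assoc h h s) ⟨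
    s ⊕ (h ⊕ h ⊕ s)             ≡⟨ cong (λ z → s ⊕ (z ⊕ s)) (⊕-self h) ⟩
    s ⊕ (0 ⊕ s)                 ≡⟨ cong (s ⊕_) (⊕-identityˡ s) ⟩
    s ⊕ s                       ≡⟨ ⊕-self s ⟩
    0                           ∎
    where
    open ≡-Reasoning
    h s : ℕ
    h = lookup hs i
    s = nimSum hs

open Nim

module ChocolateBar where

  open import Data.Empty using (⊥; ⊥-elim)
  open import Data.Fin using (zero; suc)
  open import Data.Integer using (_+_; _-_; -_; _<_; _≤_; ∣_∣; +<+)
  open import Data.Integer.Properties
    using (0≤i⇒+∣i∣≡i; i≤j⇒0≤j-i; +-monoʳ-<; neg-mono-<; neg-cancel-<; drop‿+<+; i-j≤i; i≤i+j)
  open import Data.Integer.Tactic.RingSolver using (solve-∀)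
  import Data.Nat as ℕ
  open import Data.Nat.Induction using (<-rec)
  import Data.Nat.Properties as ℕ
  open import Data.Product using (∃-syntax; _×_; proj₁; proj₂)
  open import Data.Vec using (Vec; []; _∷_; lookup; _[_]≔_; sum)
  open import Function.Bundles using (mk⇔)
  open import Relation.Binary.PropositionalEquality
  open import Relation.Nullary using (yes; no)

  +-cancelˡ-< : ∀ p {x y} → p + x < p + y → x < y
  +-cancelˡ-< p {x} {y} lt = subst₂ _<_ (cancel p x) (cancel p y) (+-monoʳ-< (- p) lt)
    where
    cancel : ∀ p x → - p + (p + x) ≡ x
    cancel = solve-∀

  cut-below : ∀ {p y l} → p - + l < y → y ≤ p → ∃[ x ] x ℕ.< l × y ≡ p - + x
  cut-below {p} {y} {l} below y≤p = ∣ p - y ∣ , x<l , y≡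
    where
    p-[p-y]≡y : ∀ p y → p - (p - y) ≡ y
    p-[p-y]≡y = solve-∀
    y≡ : y ≡ p - + ∣ p - y ∣
    y≡ = trans (sym (p-[p-y]≡y p y)) (cong (λ z → p - z) (sym (0≤i⇒+∣i∣≡i (i≤j⇒0≤j-i y≤p))))
    x<l : ∣ p - y ∣ ℕ.< l
    x<l = drop‿+<+ (neg-cancel-< (+-cancelˡ-< p (subst (p - + l <_) y≡ below)))

  cut-above : ∀ {p y r} → y < p + + r → p ≤ y → ∃[ x ] x ℕ.< r × y ≡ p + + x
  cut-above {p} {y} {r} above p≤y = ∣ y - p ∣ , x<r , y≡
    where
    p+[y-p]≡y : ∀ p y → p + (y - p) ≡ y
    p+[y-p]≡y = solve-∀
    y≡ : y ≡ p + + ∣ y - p ∣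
    y≡ = trans (sym (p+[y-p]≡y p y)) (cong (λ z → p + z) (sym (0≤i⇒+∣i∣≡i (i≤j⇒0≤j-i p≤y))))
    x<r : ∣ y - p ∣ ℕ.< r
    x<r = drop‿+<+ (+-cancelˡ-< p (subst (_< p + + r) y≡ above))

  barAround : ℤ → ℤ → Vec ℕ 4 → Bar
  barAround p q (l ∷ r ∷ d ∷ u ∷ []) = bar (p - + l) (p + + r) (q - + d) (q + + u)

  move⇒heap-lowered : ∀ {p q hs b} → Move p q (barAround p q hs) b →
                      ∃[ i ] ∃[ x ] x ℕ.< lookup hs i × b ≡ barAround p q (hs [ i ]≔ x)
  move⇒heap-lowered {hs = _ ∷ _ ∷ _ ∷ _ ∷ []} (cut-left  lt le) with x , x< , refl ← cut-below lt le
    = zero , x , x< , refl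
  move⇒heap-lowered {hs = _ ∷ _ ∷ _ ∷ _ ∷ []} (cut-right lt le) with x , x< , refl ← cut-above lt le
    = suc zero , x , x< , refl
  move⇒heap-lowered {hs = _ ∷ _ ∷ _ ∷ _ ∷ []} (cut-down  lt le) with x , x< , refl ← cut-below lt le
    = suc (suc zero) , x , x< , refl
  move⇒heap-lowered {hs = _ ∷ _ ∷ _ ∷ _ ∷ []} (cut-up    lt le) with x , x< , refl ← cut-above lt le
    = suc (suc (suc zero)) , x , x< , refl

  heap-lowered⇒move : ∀ {p q} hs i {x} → x ℕ.< lookup hs i →
                      Move p q (barAround p q hs) (barAround p q (hs [ i ]≔ x))
  heap-lowered⇒move {p}     (_ ∷ _ ∷ _ ∷ _ ∷ []) zero                   {x} x< =
    cut-left (+-monoʳ-< p (neg-mono-< (+<+ x<))) (i-j≤i p (+ x))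
  heap-lowered⇒move {p}     (_ ∷ _ ∷ _ ∷ _ ∷ []) (suc zero)             {x} x< =
    cut-right (+-monoʳ-< p (+<+ x<)) (i≤i+j p (+ x))
  heap-lowered⇒move {q = q} (_ ∷ _ ∷ _ ∷ _ ∷ []) (suc (suc zero))       {x} x< =
    cut-down (+-monoʳ-< q (neg-mono-< (+<+ x<))) (i-j≤i q (+ x))
  heap-lowered⇒move {q = q} (_ ∷ _ ∷ _ ∷ _ ∷ []) (suc (suc (suc zero))) {x} x< =
    cut-up (+-monoʳ-< q (+<+ x<)) (i≤i+j q (+ x))

  PPos⇒¬NPos : ∀ {p q b} → PPos p q b → NPos p q b → ⊥
  PPos⇒¬NPos (ppos reply) (npos mv lost) = PPos⇒¬NPos lost (reply mv)

  sum-[]≔-< : ∀ {n} (hs : Vec ℕ n) i {x} → x ℕ.< lookup hs i → sum (hs [ i ]≔ x) ℕ.< sum hs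
  sum-[]≔-< (h ∷ hs) zero    x<h = ℕ.+-monoˡ-< (sum hs) x<h
  sum-[]≔-< (h ∷ hs) (suc i) x<h = ℕ.+-monoʳ-< h (sum-[]≔-< hs i x<h)

  module _ (p q : ℤ) where

    Outcome : Vec ℕ 4 → Set
    Outcome hs = (nimSum hs ≡ 0 → PPos p q (barAround p q hs)) × (nimSum hs ≢ 0 → NPos p q (barAround p q hs))

    outcome : ∀ hs → Outcome hs
    outcome hs = <-rec (λ t → ∀ hs → sum hs ≡ t → Outcome hs) step (sum hs) hs refl
      where
      step : ∀ t → (∀ {t′} → t′ ℕ.< t → ∀ hs → sum hs ≡ t′ → Outcome hs) →
             ∀ hs → sum hs ≡ t → Outcome hs
      step _ rec hs refl = losing , winning
        where
        after : ∀ i {x} → x ℕ.< lookup hs i → Outcome (hs [ i ]≔ x)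
        after i x< = rec (sum-[]≔-< hs i x<) _ refl

        losing : nimSum hs ≡ 0 → PPos p q (barAround p q hs)
        losing sum≡0 = ppos reply
          where
          reply : ∀ {b} → Move p q (barAround p q hs) b → NPos p q b
          reply mv with i , x , x< , refl ← move⇒heap-lowered {hs = hs} mv
            = proj₂ (after i x<) (nimSum-[]≔-≢0 hs i sum≡0 x<)

        winning : nimSum hs ≢ 0 → NPos p q (barAround p q hs)
        winning sum≢0 with i , lowered ← nimSum≢0⇒lowerable hs sum≢0
          = npos (heap-lowered⇒move hs i lowered) (proj₁ (after i lowered) (nimSum-[]≔-⊕nimSum hs i))

  PPos⇔nimSum≡0 : ∀ p q hs → PPos p q (barAround p q hs) ⇔ nimSum hs ≡ 0
  PPos⇔nimSum≡0 p q hs = mk⇔ losing⇒zero (proj₁ (outcome p q hs))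
    where
    losing⇒zero : PPos p q (barAround p q hs) → nimSum hs ≡ 0
    losing⇒zero pp with nimSum hs ℕ.≟ 0
    ... | yes sum≡0 = sum≡0
    ... | no  sum≢0 = ⊥-elim (PPos⇒¬NPos pp (proj₂ (outcome p q hs) sum≢0))

open ChocolateBar

-- A grid F stands for the power series Σ F i j xⁱ yʲ over GF(2): _+ᴳ_ is addition, X and Y are
-- multiplication by x and y, and frob F is F(x², y²).
module PowerSeriesMod2 where

  open import Algebra.Bundles using (AbelianGroup; CommutativeRing)
  import Algebra.Construct.Pointwise as Pointwise
  import Algebra.Solver.CommutativeMonoid as CommutativeMonoidSolver
  open import Data.Bool using (Bool; true; false; not; _∧_; _xor_)
  open import Data.Bool.Properties using (xor-∧-commutativeRing; ∧-zeroʳ; ∧-distribˡ-xor; xor-identityʳ)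
  open import Data.Nat using (zero; suc; ⌊_/2⌋)
  open import Relation.Binary.PropositionalEquality using (refl; cong; cong₂; subst₂)
    renaming (trans to ≡-trans; sym to ≡-sym)

  Grid : Set
  Grid = ℕ → ℕ → Bool

  gridGroup : AbelianGroup _ _
  gridGroup = Pointwise.abelianGroup ℕ (Pointwise.abelianGroup ℕ
                (CommutativeRing.+-abelianGroup xor-∧-commutativeRing))

  open AbelianGroup gridGroup public
    using (_≈_; assoc; identityˡ; identityʳ; inverseʳ)
    renaming (_∙_ to _+ᴳ_; ε to 0ᴳ; setoid to ≈-setoid; ∙-cong to +ᴳ-cong;
              refl to ≈-refl; sym to ≈-sym; trans to ≈-trans)

  private module GridSolver = CommutativeMonoidSolver (AbelianGroup.commutativeMonoid gridGroup)
  open import Relation.Binary.Reasoning.Setoid ≈-setoid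

  private
    variable
      F G H : Grid

  X : Grid → Grid
  X F zero    j = false
  X F (suc i) j = F i j

  Y : Grid → Grid
  Y F i zero    = false
  Y F i (suc j) = F i j

  XY : Grid → Grid
  XY F = X (Y F)

  Dˣ : Grid → Grid
  Dˣ F = F +ᴳ X F

  Dʸ : Grid → Grid
  Dʸ F = F +ᴳ Y F

  P : Grid → Grid
  P F = Dˣ (Dʸ F)

  next : Grid → Grid → Grid
  next F G = P F +ᴳ XY G

  frob : Grid → Grid
  frob F i j = not (lsb i) ∧ not (lsb j) ∧ F ⌊ i /2⌋ ⌊ j /2⌋

  +ᴳ-congˡ : ∀ F → G ≈ H → F +ᴳ G ≈ F +ᴳ H
  +ᴳ-congˡ F G≈H i j = cong (F i j xor_) (G≈H i j)

  +ᴳ-congʳ : ∀ H → F ≈ G → F +ᴳ H ≈ G +ᴳ H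
  +ᴳ-congʳ H F≈G i j = cong (_xor H i j) (F≈G i j)

  X-cong : F ≈ G → X F ≈ X G
  X-cong F≈G zero    j = refl
  X-cong F≈G (suc i) j = F≈G i j

  Y-cong : F ≈ G → Y F ≈ Y G
  Y-cong F≈G i zero    = refl
  Y-cong F≈G i (suc j) = F≈G i j

  frob-cong : F ≈ G → frob F ≈ frob G
  frob-cong F≈G i j = cong (not (lsb i) ∧_) (cong (not (lsb j) ∧_) (F≈G ⌊ i /2⌋ ⌊ j /2⌋))

  Dˣ-cong : F ≈ G → Dˣ F ≈ Dˣ G
  Dˣ-cong F≈G = +ᴳ-cong F≈G (X-cong F≈G)

  Dʸ-cong : F ≈ G → Dʸ F ≈ Dʸ G
  Dʸ-cong F≈G = +ᴳ-cong F≈G (Y-cong F≈G)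

  P-cong : F ≈ G → P F ≈ P G
  P-cong F≈G = Dˣ-cong (Dʸ-cong F≈G)

  next-cong : ∀ {F F′ G G′} → F ≈ F′ → G ≈ G′ → next F G ≈ next F′ G′
  next-cong F≈F′ G≈G′ = +ᴳ-cong (P-cong F≈F′) (X-cong (Y-cong G≈G′))

  X-+ : ∀ F G → X (F +ᴳ G) ≈ X F +ᴳ X G
  X-+ F G zero    j = refl
  X-+ F G (suc i) j = refl

  Y-+ : ∀ F G → Y (F +ᴳ G) ≈ Y F +ᴳ Y G
  Y-+ F G i zero    = refl
  Y-+ F G i (suc j) = refl

  XY-+ : ∀ F G → XY (F +ᴳ G) ≈ XY F +ᴳ XY G
  XY-+ F G = ≈-trans (X-cong (Y-+ F G)) (X-+ (Y F) (Y G))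

  X-Y : ∀ F → X (Y F) ≈ Y (X F)
  X-Y F zero    zero    = refl
  X-Y F zero    (suc j) = refl
  X-Y F (suc i) zero    = refl
  X-Y F (suc i) (suc j) = refl

  frob-+ : ∀ F G → frob (F +ᴳ G) ≈ frob F +ᴳ frob G
  frob-+ F G i j = ≡-trans (cong (not (lsb i) ∧_) (∧-distribˡ-xor (not (lsb j)) _ _))
                           (∧-distribˡ-xor (not (lsb i)) _ _)

  frob-X : ∀ F → frob (X F) ≈ X (X (frob F))
  frob-X F zero          j = ∧-zeroʳ (not (lsb j))
  frob-X F (suc zero)    j = refl
  frob-X F (suc (suc i)) j = refl

  frob-Y : ∀ F → frob (Y F) ≈ Y (Y (frob F))
  frob-Y F i zero          = ∧-zeroʳ (not (lsb i))
  frob-Y F i (suc zero)    = ∧-zeroʳ (not (lsb i))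
  frob-Y F i (suc (suc j)) = refl

  private
    interchange : ∀ A B C D → (A +ᴳ B) +ᴳ (C +ᴳ D) ≈ (A +ᴳ C) +ᴳ (B +ᴳ D)
    interchange = solve 4 (λ a b c d → (a ⊞ b) ⊞ (c ⊞ d) ⊜ (a ⊞ c) ⊞ (b ⊞ d)) ≈-refl
      where open GridSolver using (solve; _⊜_) renaming (_⊕_ to _⊞_)

    regroup : ∀ A B C → (A +ᴳ B) +ᴳ (B +ᴳ C) ≈ A +ᴳ ((B +ᴳ B) +ᴳ C)
    regroup = solve 3 (λ a b c → (a ⊞ b) ⊞ (b ⊞ c) ⊜ a ⊞ ((b ⊞ b) ⊞ c)) ≈-refl
      where open GridSolver using (solve; _⊜_) renaming (_⊕_ to _⊞_)

    rotate : ∀ A B C → A +ᴳ (B +ᴳ C) ≈ (A +ᴳ C) +ᴳ B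
    rotate = solve 3 (λ a b c → a ⊞ (b ⊞ c) ⊜ (a ⊞ c) ⊞ b) ≈-refl
      where open GridSolver using (solve; _⊜_) renaming (_⊕_ to _⊞_)

  Dˣ-+ : ∀ F G → Dˣ (F +ᴳ G) ≈ Dˣ F +ᴳ Dˣ G
  Dˣ-+ F G = ≈-trans (+ᴳ-congˡ (F +ᴳ G) (X-+ F G)) (interchange F G (X F) (X G))

  Dʸ-+ : ∀ F G → Dʸ (F +ᴳ G) ≈ Dʸ F +ᴳ Dʸ G
  Dʸ-+ F G = ≈-trans (+ᴳ-congˡ (F +ᴳ G) (Y-+ F G)) (interchange F G (Y F) (Y G))

  P-+ : ∀ F G → P (F +ᴳ G) ≈ P F +ᴳ P G
  P-+ F G = ≈-trans (Dˣ-cong (Dʸ-+ F G)) (Dˣ-+ (Dʸ F) (Dʸ G))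

  P-XY : ∀ F → P (XY F) ≈ XY (P F)
  P-XY F = ≈-trans (Dˣ-cong Dʸ-XY) Dˣ-XY
    where
    Dʸ-XY : Dʸ (XY F) ≈ XY (Dʸ F)
    Dʸ-XY = ≈-trans (+ᴳ-congˡ (XY F) (≈-sym (X-Y (Y F)))) (≈-sym (XY-+ F (Y F)))
    Dˣ-XY : Dˣ (XY (Dʸ F)) ≈ XY (Dˣ (Dʸ F))
    Dˣ-XY = ≈-trans (+ᴳ-congˡ (XY (Dʸ F)) (X-cong (X-Y (Dʸ F)))) (≈-sym (XY-+ (Dʸ F) (X (Dʸ F))))

  Dˣ-Dʸ : ∀ F → Dˣ (Dʸ F) ≈ Dʸ (Dˣ F)
  Dˣ-Dʸ F = begin
    Dʸ F +ᴳ X (F +ᴳ Y F)      ≈⟨ +ᴳ-congˡ (Dʸ F) (X-+ F (Y F)) ⟩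
    Dʸ F +ᴳ (X F +ᴳ X (Y F))  ≈⟨ interchange F (Y F) (X F) (X (Y F)) ⟩
    Dˣ F +ᴳ (Y F +ᴳ X (Y F))  ≈⟨ +ᴳ-congˡ (Dˣ F) (+ᴳ-congˡ (Y F) (X-Y F)) ⟩
    Dˣ F +ᴳ (Y F +ᴳ Y (X F))  ≈⟨ +ᴳ-congˡ (Dˣ F) (≈-sym (Y-+ F (X F))) ⟩
    Dʸ (Dˣ F)                 ∎

  Dˣ-square : ∀ F → Dˣ (Dˣ F) ≈ F +ᴳ X (X F)
  Dˣ-square F = begin
    Dˣ F +ᴳ X (F +ᴳ X F)            ≈⟨ +ᴳ-congˡ (Dˣ F) (X-+ F (X F)) ⟩
    Dˣ F +ᴳ (X F +ᴳ X (X F))        ≈⟨ regroup F (X F) (X (X F)) ⟩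
    F +ᴳ ((X F +ᴳ X F) +ᴳ X (X F))  ≈⟨ +ᴳ-congˡ F (≈-trans (+ᴳ-congʳ (X (X F)) (inverseʳ (X F)))
                                                           (identityˡ (X (X F)))) ⟩
    F +ᴳ X (X F)                    ∎

  Dʸ-square : ∀ F → Dʸ (Dʸ F) ≈ F +ᴳ Y (Y F)
  Dʸ-square F = begin
    Dʸ F +ᴳ Y (F +ᴳ Y F)            ≈⟨ +ᴳ-congˡ (Dʸ F) (Y-+ F (Y F)) ⟩
    Dʸ F +ᴳ (Y F +ᴳ Y (Y F))        ≈⟨ regroup F (Y F) (Y (Y F)) ⟩
    F +ᴳ ((Y F +ᴳ Y F) +ᴳ Y (Y F))  ≈⟨ +ᴳ-congˡ F (≈-trans (+ᴳ-congʳ (Y (Y F)) (inverseʳ (Y F)))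
                                                           (identityˡ (Y (Y F)))) ⟩
    F +ᴳ Y (Y F)                    ∎

  frob-P : ∀ F → frob (P F) ≈ P (P (frob F))
  frob-P F = begin
    frob (Dˣ (Dʸ F))                     ≈⟨ ≈-trans (frob-+ (Dʸ F) (X (Dʸ F)))
                                                    (+ᴳ-congˡ (frob (Dʸ F)) (frob-X (Dʸ F))) ⟩
    frob (Dʸ F) +ᴳ X (X (frob (Dʸ F)))   ≈⟨ Dˣ-square (frob (Dʸ F)) ⟨
    Dˣ (Dˣ (frob (Dʸ F)))                ≈⟨ Dˣ-cong (Dˣ-cong (≈-trans (frob-+ F (Y F))
                                                                      (+ᴳ-congˡ (frob F) (frob-Y F)))) ⟩
    Dˣ (Dˣ (frob F +ᴳ Y (Y (frob F))))   ≈⟨ Dˣ-cong (Dˣ-cong (Dʸ-square (frob F))) ⟨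
    Dˣ (Dˣ (Dʸ (Dʸ (frob F))))           ≈⟨ Dˣ-cong (Dˣ-Dʸ (Dʸ (frob F))) ⟩
    P (P (frob F))                       ∎

  frob-XY : ∀ F → frob (XY F) ≈ XY (XY (frob F))
  frob-XY F = begin
    frob (X (Y F))          ≈⟨ frob-X (Y F) ⟩
    X (X (frob (Y F)))      ≈⟨ X-cong (X-cong (frob-Y F)) ⟩
    X (X (Y (Y (frob F))))  ≈⟨ X-cong (X-Y (Y (frob F))) ⟩
    XY (XY (frob F))        ∎

  next-even : ∀ F G → next (F +ᴳ XY G) (P G) ≈ P F
  next-even F G = begin
    P (F +ᴳ XY G) +ᴳ XY (P G)      ≈⟨ +ᴳ-cong (P-+ F (XY G)) (≈-sym (P-XY G)) ⟩
    (P F +ᴳ P (XY G)) +ᴳ P (XY G)  ≈⟨ assoc (P F) (P (XY G)) (P (XY G)) ⟩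
    P F +ᴳ (P (XY G) +ᴳ P (XY G))  ≈⟨ +ᴳ-congˡ (P F) (inverseʳ (P (XY G))) ⟩
    P F +ᴳ 0ᴳ                      ≈⟨ identityʳ (P F) ⟩
    P F                            ∎

  next-odd : ∀ F G → next (P (frob F)) (frob F +ᴳ XY (frob G)) ≈ frob (next F G) +ᴳ XY (frob F)
  next-odd F G = begin
    P (P (frob F)) +ᴳ XY (frob F +ᴳ XY (frob G))
      ≈⟨ +ᴳ-cong (≈-sym (frob-P F)) (XY-+ (frob F) (XY (frob G))) ⟩
    frob (P F) +ᴳ (XY (frob F) +ᴳ XY (XY (frob G)))
      ≈⟨ +ᴳ-congˡ (frob (P F)) (+ᴳ-congˡ (XY (frob F)) (≈-sym (frob-XY G))) ⟩
    frob (P F) +ᴳ (XY (frob F) +ᴳ frob (XY G))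
      ≈⟨ rotate (frob (P F)) (XY (frob F)) (frob (XY G)) ⟩
    (frob (P F) +ᴳ frob (XY G)) +ᴳ XY (frob F)
      ≈⟨ +ᴳ-congʳ (XY (frob F)) (≈-sym (frob-+ (P F) (XY G))) ⟩
    frob (next F G) +ᴳ XY (frob F)
      ∎

  ≈-by-blocks : (∀ u b v c → F (u ·2+ b) (v ·2+ c) ≡ G (u ·2+ b) (v ·2+ c)) → F ≈ G
  ≈-by-blocks {F = F} {G = G} blocks i j =
    subst₂ (λ i j → F i j ≡ G i j) (⌊/2⌋·2+lsb i) (⌊/2⌋·2+lsb j) (blocks ⌊ i /2⌋ (lsb i) ⌊ j /2⌋ (lsb j))

  frob-block : ∀ F u b v c → frob F (u ·2+ b) (v ·2+ c) ≡ not b ∧ not c ∧ F u v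
  frob-block F u b v c rewrite lsb-·2+ u b | lsb-·2+ v c | ⌊·2+/2⌋ u b | ⌊·2+/2⌋ v c = refl

  X-frob-block : ∀ F u b v c → X (frob F) (u ·2+ b) (v ·2+ c) ≡ b ∧ not c ∧ F u v
  X-frob-block F u       true  v c = frob-block F u false v c
  X-frob-block F zero    false v c = refl
  X-frob-block F (suc u) false v c = frob-block F u true v c

  Y-frob-block : ∀ F u b v c → Y (frob F) (u ·2+ b) (v ·2+ c) ≡ not b ∧ c ∧ F u v
  Y-frob-block F u b v       true  = frob-block F u b v false
  Y-frob-block F u b zero    false = ≡-sym (∧-zeroʳ (not b))
  Y-frob-block F u b (suc v) false = frob-block F u b v true

  XY-frob-block : ∀ F u b v c → XY (frob F) (u ·2+ b) (v ·2+ c) ≡ b ∧ c ∧ F u v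
  XY-frob-block F u       true  v c = Y-frob-block F u false v c
  XY-frob-block F zero    false v c = refl
  XY-frob-block F (suc u) false v c = Y-frob-block F u true v c

  P-frob-block : ∀ F u b v c → P (frob F) (u ·2+ b) (v ·2+ c) ≡ F u v
  P-frob-block F u b v c =
    ≡-trans (cong ((Q i j xor Y Q i j) xor_) (X-+ Q (Y Q) i j))
            (≡-trans (cong₂ _xor_ (cong₂ _xor_ (frob-block F u b v c) (Y-frob-block F u b v c))
                                  (cong₂ _xor_ (X-frob-block F u b v c) (XY-frob-block F u b v c)))
                     (one-block b c (F u v)))
    where
    Q : Grid
    Q = frob F
    i j : ℕ
    i = u ·2+ b
    j = v ·2+ c
    one-block : ∀ b c x →
                ((not b ∧ not c ∧ x) xor (not b ∧ c ∧ x)) xor ((b ∧ not c ∧ x) xor (b ∧ c ∧ x)) ≡ x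
    one-block false false x = ≡-trans (xor-identityʳ _) (xor-identityʳ x)
    one-block false true  x = xor-identityʳ x
    one-block true  false x = xor-identityʳ x
    one-block true  true  x = refl

open PowerSeriesMod2

module LosingCells where

  open import Data.Bool using (true; false; not; _∧_; _xor_; T)
  open import Data.Bool.Properties using (xor-inverseʳ; xor-identityʳ; not-¬)
  open import Data.Empty using (⊥-elim)
  open import Data.Nat using (zero; suc; _∸_; _<_; _<ᵇ_; _≡ᵇ_; z≤n; s≤s; ⌊_/2⌋)
  open import Data.Nat.Induction using (<-rec)
  open import Data.Nat.Properties using (<ᵇ⇒<; ≡ᵇ⇒≡; m+[n∸m]≡n; ≤-trans; n≤1+n)
  open import Data.Unit using (tt)
  open import Relation.Binary.PropositionalEquality

  ≡ᵇ-refl : ∀ n → (n ≡ᵇ n) ≡ true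
  ≡ᵇ-refl zero    = refl
  ≡ᵇ-refl (suc n) = ≡ᵇ-refl n

  ≢⇒≡ᵇ≡false : ∀ {m n} → m ≢ n → (m ≡ᵇ n) ≡ false
  ≢⇒≡ᵇ≡false {m} {n} m≢n with m ≡ᵇ n in eq
  ... | true  = ⊥-elim (m≢n (≡ᵇ⇒≡ m n (subst T (sym eq) tt)))
  ... | false = refl

  ∧-congʳ-T : ∀ {x y z} → (T x → y ≡ z) → x ∧ y ≡ x ∧ z
  ∧-congʳ-T {false} _   = refl
  ∧-congʳ-T {true}  y≡z = y≡z tt

  ∧-zeroʳ-T : ∀ {x y} → (T x → y ≡ false) → x ∧ y ≡ false
  ∧-zeroʳ-T {false} _       = refl
  ∧-zeroʳ-T {true}  y≡false = y≡false tt

  rowNimSum : ℕ → ℕ → ℕ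
  rowNimSum n i = i ⊕ (n ∸ suc i)

  rowNimSum-double : ∀ {u k} b → u < k → rowNimSum (double k) (u ·2+ b) ≡ rowNimSum k u ·2+ true
  rowNimSum-double {u} {k} b u<k = begin
    (u ·2+ b) ⊕ (double k ∸ suc (u ·2+ b))  ≡⟨ cong ((u ·2+ b) ⊕_) (double-∸-suc b u<k) ⟩
    (u ·2+ b) ⊕ ((k ∸ suc u) ·2+ not b)     ≡⟨ ·2+-⊕-·2+ u b (k ∸ suc u) (not b) ⟩
    rowNimSum k u ·2+ (b xor not b)         ≡⟨ cong (rowNimSum k u ·2+_) (xor-inverseʳ b) ⟩
    rowNimSum k u ·2+ true                  ∎
    where open ≡-Reasoning

  rowNimSum-odd-even : ∀ u k → rowNimSum (suc (double k)) (double u) ≡ rowNimSum (suc k) u ·2+ false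
  rowNimSum-odd-even u k = trans (cong (double u ⊕_) (double-∸ k u)) (·2+-⊕-·2+ u false (k ∸ u) false)

  rowNimSum-odd-odd : ∀ {u k} → u < k → rowNimSum (suc (double k)) (suc (double u)) ≡ rowNimSum k u ·2+ false
  rowNimSum-odd-odd {u} {k} u<k =
    trans (cong (suc (double u) ⊕_) (double-∸-suc false u<k)) (·2+-⊕-·2+ u true (k ∸ suc u) true)

  lsb-rowNimSum : ∀ {i n} → i < suc n → lsb (rowNimSum (suc n) i) ≡ lsb n
  lsb-rowNimSum {i} {n} (s≤s i≤n) =
    trans (lsb-⊕ i (n ∸ i)) (trans (sym (lsb-+ i (n ∸ i))) (cong lsb (m+[n∸m]≡n i≤n)))

  -- The two halves are row nim-sums of rows of lengths k + 1 and k, and their parities differ.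
  rowNimSum-odd-≢ : ∀ {u v k} → u < suc k → v < k →
                    rowNimSum (suc (double k)) (double u) ≢ rowNimSum (suc (double k)) (suc (double v))
  rowNimSum-odd-≢ {u} {v} {suc k} u<k+2 v<k+1 eq = not-¬ refl (trans (sym same-lsb) (lsb-suc k))
    where
    halves : rowNimSum (suc (suc k)) u ≡ rowNimSum (suc k) v
    halves = begin
      rowNimSum (suc (suc k)) u                  ≡⟨ ⌊·2+/2⌋ (rowNimSum (suc (suc k)) u) false ⟨
      ⌊ rowNimSum (suc (suc k)) u ·2+ false /2⌋  ≡⟨ cong ⌊_/2⌋ (trans (sym (rowNimSum-odd-even u (suc k)))
                                                               (trans eq (rowNimSum-odd-odd v<k+1))) ⟩
      ⌊ rowNimSum (suc k) v ·2+ false /2⌋        ≡⟨ ⌊·2+/2⌋ (rowNimSum (suc k) v) false ⟩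
      rowNimSum (suc k) v                        ∎
      where open ≡-Reasoning
    same-lsb : lsb (suc k) ≡ lsb k
    same-lsb = trans (sym (lsb-rowNimSum u<k+2)) (trans (cong lsb halves) (lsb-rowNimSum v<k+1))

  -- 0-based: losing n i j is the P-position test for the poison at cell (i + 1, j + 1) of the n × n bar.
  losing : ℕ → Grid
  losing n i j = (i <ᵇ n) ∧ (j <ᵇ n) ∧ (rowNimSum n i ≡ᵇ rowNimSum n j)

  losing-bounds : ∀ n i j {x y} → (i <ᵇ n) ≡ x → (j <ᵇ n) ≡ y →
                  losing n i j ≡ x ∧ y ∧ (rowNimSum n i ≡ᵇ rowNimSum n j)
  losing-bounds n i j = cong₂ (λ x y → x ∧ y ∧ (rowNimSum n i ≡ᵇ rowNimSum n j))

  losing-double : ∀ k u b v c → losing (double k) (u ·2+ b) (v ·2+ c) ≡ losing k u v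
  losing-double k u b v c =
    trans (losing-bounds (double k) (u ·2+ b) (v ·2+ c) (·2+<ᵇdouble u b k) (·2+<ᵇdouble v c k))
          (∧-congʳ-T λ u<k → ∧-congʳ-T λ v<k →
             trans (cong₂ _≡ᵇ_ (rowNimSum-double b (<ᵇ⇒< u k u<k)) (rowNimSum-double c (<ᵇ⇒< v k v<k)))
                   (·2+≡ᵇ·2+ (rowNimSum k u) (rowNimSum k v) true))

  losing-odd : ∀ k u b v c →
    losing (suc (double k)) (u ·2+ b) (v ·2+ c) ≡
    (not b ∧ not c ∧ losing (suc k) u v) xor (b ∧ c ∧ losing k u v)
  losing-odd k u false v false =
    trans (losing-bounds (suc (double k)) (double u) (double v) (double<ᵇsuc-double u k) (double<ᵇsuc-double v k))
          (trans (cong ((u <ᵇ suc k) ∧_) (cong ((v <ᵇ suc k) ∧_)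
                   (trans (cong₂ _≡ᵇ_ (rowNimSum-odd-even u k) (rowNimSum-odd-even v k))
                          (·2+≡ᵇ·2+ (rowNimSum (suc k) u) (rowNimSum (suc k) v) false))))
                 (sym (xor-identityʳ _)))
  losing-odd k u true v true =
    trans (losing-bounds (suc (double k)) (suc (double u)) (suc (double v))
                         (·2+<ᵇdouble u false k) (·2+<ᵇdouble v false k))
          (∧-congʳ-T λ u<k → ∧-congʳ-T λ v<k →
             trans (cong₂ _≡ᵇ_ (rowNimSum-odd-odd (<ᵇ⇒< u k u<k)) (rowNimSum-odd-odd (<ᵇ⇒< v k v<k)))
                   (·2+≡ᵇ·2+ (rowNimSum k u) (rowNimSum k v) false))
  losing-odd k u false v true =
    trans (losing-bounds (suc (double k)) (double u) (suc (double v))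
                         (double<ᵇsuc-double u k) (·2+<ᵇdouble v false k))
          (∧-zeroʳ-T λ u<k+1 → ∧-zeroʳ-T λ v<k →
             ≢⇒≡ᵇ≡false (rowNimSum-odd-≢ (<ᵇ⇒< u (suc k) u<k+1) (<ᵇ⇒< v k v<k)))
  losing-odd k u true v false =
    trans (losing-bounds (suc (double k)) (suc (double u)) (double v)
                         (·2+<ᵇdouble u false k) (double<ᵇsuc-double v k))
          (∧-zeroʳ-T λ u<k → ∧-zeroʳ-T λ v<k+1 →
             ≢⇒≡ᵇ≡false (λ eq → rowNimSum-odd-≢ (<ᵇ⇒< v (suc k) v<k+1) (<ᵇ⇒< u k u<k) (sym eq)))

  losing-double≈ : ∀ k → losing (double k) ≈ P (frob (losing k))
  losing-double≈ k = ≈-by-blocks λ u b v c →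
    trans (losing-double k u b v c) (sym (P-frob-block (losing k) u b v c))

  losing-odd≈ : ∀ k → losing (suc (double k)) ≈ frob (losing (suc k)) +ᴳ XY (frob (losing k))
  losing-odd≈ k = ≈-by-blocks λ u b v c →
    trans (losing-odd k u b v c)
          (sym (cong₂ _xor_ (frob-block (losing (suc k)) u b v c) (XY-frob-block (losing k) u b v c)))

  data EvenOdd : ℕ → Set where
    even : ∀ k → EvenOdd (double k)
    odd  : ∀ k → EvenOdd (suc (double k))

  evenOdd : ∀ n → EvenOdd n
  evenOdd zero = even zero
  evenOdd (suc n) with evenOdd n
  ... | even k = odd k
  ... | odd  k = even (suc k)

  losing-next : ∀ n → losing (suc (suc n)) ≈ next (losing (suc n)) (losing n)
  losing-next = <-rec _ step
    where
    open import Relation.Binary.Reasoning.Setoid ≈-setoid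
    k<2k+1 : ∀ k → k < suc (double k)
    k<2k+1 zero    = s≤s z≤n
    k<2k+1 (suc k) = s≤s (≤-trans (k<2k+1 k) (n≤1+n _))
    step : ∀ n → (∀ {m} → m < n → losing (suc (suc m)) ≈ next (losing (suc m)) (losing m)) →
           losing (suc (suc n)) ≈ next (losing (suc n)) (losing n)
    step n rec with evenOdd n
    ... | even k = begin
      losing (double (suc k))                             ≈⟨ losing-double≈ (suc k) ⟩
      P (frob A)                                          ≈⟨ next-even (frob A) (frob B) ⟨
      next (frob A +ᴳ XY (frob B)) (P (frob B))            ≈⟨ next-cong (losing-odd≈ k) (losing-double≈ k) ⟨
      next (losing (suc (double k))) (losing (double k))  ∎
      where
      A B : Grid
      A = losing (suc k)
      B = losing k
    ... | odd k = begin
      losing (suc (double (suc k)))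
        ≈⟨ losing-odd≈ (suc k) ⟩
      frob (losing (suc (suc k))) +ᴳ XY (frob A)
        ≈⟨ +ᴳ-congʳ (XY (frob A)) (frob-cong (rec (k<2k+1 k))) ⟩
      frob (next A B) +ᴳ XY (frob A)
        ≈⟨ next-odd A B ⟨
      next (P (frob A)) (frob A +ᴳ XY (frob B))
        ≈⟨ next-cong (losing-double≈ (suc k)) (losing-odd≈ k) ⟨
      next (losing (double (suc k))) (losing (suc (double k)))
        ∎
      where
      A B : Grid
      A = losing (suc k)
      B = losing k

open LosingCells

module SequenceModTwo where

  open import Data.Bool using (Bool; false; _xor_; T; if_then_else_)
  open import Data.Bool.Properties using (∧-zeroʳ)
  open import Data.Bool.Solver using (module xor-∧-Solver)
  open import Data.Empty using (⊥-elim)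
  open import Data.Integer using (_+_; _-_; _≤_; _≟_; +≤+)
  open import Data.Integer.Properties using (i≤j⇒i-k≤j)
  import Data.Nat as ℕ
  open import Data.Nat using (zero; suc; z≤n)
  open import Data.Product using (∃-syntax; _×_)
  open import Data.Unit using (tt)
  open import Function.Bundles using (mk⇔)
  open import Relation.Binary.PropositionalEquality
  open import Relation.Nullary using (¬_; yes; no)

  NatWithLsb : ℤ → Bool → Set
  NatWithLsb z b = ∃[ k ] z ≡ + k × lsb k ≡ b

  NatWithLsb-0 : NatWithLsb (+ 0) false
  NatWithLsb-0 = 0 , refl , refl

  NatWithLsb-+ : ∀ {x y b c} → NatWithLsb x b → NatWithLsb y c → NatWithLsb (x + y) (b xor c)
  NatWithLsb-+ (k , refl , refl) (l , refl , refl) = k ℕ.+ l , refl , lsb-+ k l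

  %2≡1⇔lsb : ∀ k → k ℕ.% 2 ≡ 1 ⇔ T (lsb k)
  %2≡1⇔lsb zero          = mk⇔ (λ ()) (λ ())
  %2≡1⇔lsb (suc zero)    = mk⇔ (λ _ → tt) (λ _ → refl)
  %2≡1⇔lsb (suc (suc k)) = %2≡1⇔lsb k

  NatWithLsb-%2 : ∀ {z b} → NatWithLsb z b → z % + 2 ≡ 1 ⇔ T b
  NatWithLsb-%2 (k , refl , refl) = %2≡1⇔lsb k

  1≰0 : ¬ (+ 1 ≤ + 0)
  1≰0 (+≤+ ())

  sum-of-zeros : ∀ {x y z w v} → x ≡ + 0 → y ≡ + 0 → z ≡ + 0 → w ≡ + 0 → v ≡ + 0 →
                 x + y + z + w + v ≡ + 0
  sum-of-zeros refl refl refl refl refl = refl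

  a-vanishes-left : ∀ n {i} j → i ≤ + 0 → a i j n ≡ + 0
  a-vanishes-left zero          j i≤0 = refl
  a-vanishes-left (suc zero) {i} j i≤0 with i ≟ + 1
  ... | no  _    = refl
  ... | yes refl = ⊥-elim (1≰0 i≤0)
  a-vanishes-left (suc (suc n)) {i} j i≤0 =
    sum-of-zeros (a-vanishes-left (suc n) j i≤0) (a-vanishes-left (suc n) j i-1≤0)
                 (a-vanishes-left (suc n) (j - + 1) i≤0) (a-vanishes-left (suc n) (j - + 1) i-1≤0)
                 (a-vanishes-left n (j - + 1) i-1≤0)
    where
    i-1≤0 : i - + 1 ≤ + 0
    i-1≤0 = i≤j⇒i-k≤j (+ 1) i≤0

  a-vanishes-right : ∀ n i {j} → j ≤ + 0 → a i j n ≡ + 0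
  a-vanishes-right zero          i     j≤0 = refl
  a-vanishes-right (suc zero)    i {j} j≤0 with j ≟ + 1
  ... | no  _    = cong (λ b → if b then + 1 else + 0) (∧-zeroʳ _)
  ... | yes refl = ⊥-elim (1≰0 j≤0)
  a-vanishes-right (suc (suc n)) i {j} j≤0 =
    sum-of-zeros (a-vanishes-right (suc n) i j≤0) (a-vanishes-right (suc n) (i - + 1) j≤0)
                 (a-vanishes-right (suc n) i j-1≤0) (a-vanishes-right (suc n) (i - + 1) j-1≤0)
                 (a-vanishes-right n (i - + 1) j-1≤0)
    where
    j-1≤0 : j - + 1 ≤ + 0
    j-1≤0 = i≤j⇒i-k≤j (+ 1) j≤0

  a-mod-2 : ℕ → Grid → Set
  a-mod-2 n G = ∀ i j → NatWithLsb (a (+ suc i) (+ suc j) n) (G i j)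

  a-mod-2-X : ∀ {n G} → a-mod-2 n G → ∀ i j → NatWithLsb (a (+ i) (+ suc j) n) (X G i j)
  a-mod-2-X {n} _  zero    j =
    subst (λ z → NatWithLsb z false) (sym (a-vanishes-left n (+ suc j) (+≤+ z≤n))) NatWithLsb-0
  a-mod-2-X     aG (suc i) j = aG i j

  a-mod-2-Y : ∀ {n G} → a-mod-2 n G → ∀ i j → NatWithLsb (a (+ suc i) (+ j) n) (Y G i j)
  a-mod-2-Y {n} _  i zero    =
    subst (λ z → NatWithLsb z false) (sym (a-vanishes-right n (+ suc i) (+≤+ z≤n))) NatWithLsb-0
  a-mod-2-Y     aG i (suc j) = aG i j

  a-mod-2-XY : ∀ {n G} → a-mod-2 n G → ∀ i j → NatWithLsb (a (+ i) (+ j) n) (XY G i j)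
  a-mod-2-XY {n} _  zero    j       =
    subst (λ z → NatWithLsb z false) (sym (a-vanishes-left n (+ j) (+≤+ z≤n))) NatWithLsb-0
  a-mod-2-XY {n} _  (suc i) zero    =
    subst (λ z → NatWithLsb z false) (sym (a-vanishes-right n (+ suc i) (+≤+ z≤n))) NatWithLsb-0
  a-mod-2-XY     aG (suc i) (suc j) = aG i j

  P-pointwise : ∀ F i j → P F i j ≡ ((F i j xor X F i j) xor Y F i j) xor XY F i j
  P-pointwise F i j =
    trans (cong ((F i j xor Y F i j) xor_) (X-+ F (Y F) i j)) (regroup (F i j) (Y F i j) (X F i j) (XY F i j))
    where
    open xor-∧-Solver
    regroup : ∀ f y x xy → (f xor y) xor (x xor xy) ≡ ((f xor x) xor y) xor xy
    regroup = solve 4 (λ f y x xy → (f :+ y) :+ (x :+ xy) := ((f :+ x) :+ y) :+ xy) refl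

  a-mod-2-next : ∀ {n F G} → a-mod-2 (suc n) F → a-mod-2 n G → a-mod-2 (suc (suc n)) (next F G)
  a-mod-2-next {n} {F} {G} aF aG i j =
    subst (NatWithLsb _) (sym (cong (_xor XY G i j) (P-pointwise F i j)))
      (NatWithLsb-+ (NatWithLsb-+ (NatWithLsb-+ (NatWithLsb-+ (aF i j) (a-mod-2-X {suc n} aF i j))
                                                             (a-mod-2-Y {suc n} aF i j))
                                  (a-mod-2-XY {suc n} aF i j))
                    (a-mod-2-XY {n} aG i j))

  a-mod-2-≈ : ∀ {n G G′} → G ≈ G′ → a-mod-2 n G → a-mod-2 n G′
  a-mod-2-≈ G≈G′ aG i j = subst (NatWithLsb _) (G≈G′ i j) (aG i j)

  a-mod-2-losing : ∀ n → a-mod-2 n (losing n)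
  a-mod-2-losing zero          i       j       = NatWithLsb-0
  a-mod-2-losing (suc zero)    zero    zero    = 1 , refl , sym (≡ᵇ-refl (rowNimSum 1 0))
  a-mod-2-losing (suc zero)    zero    (suc j) = NatWithLsb-0
  a-mod-2-losing (suc zero)    (suc i) j       = NatWithLsb-0
  a-mod-2-losing (suc (suc n)) =
    a-mod-2-≈ {suc (suc n)} (≈-sym (losing-next n))
              (a-mod-2-next {n} (a-mod-2-losing (suc n)) (a-mod-2-losing n))

open SequenceModTwo

open import Data.Bool using (T)
open import Data.Bool.Properties using (T-∧)
open import Data.Empty using (⊥; ⊥-elim)
open import Data.Integer as ℤ using (-[1+_]; _-_; _≤_; +≤+; -≤+)
open import Data.Integer.Properties using (≤-trans)
open import Data.Integer.Tactic.RingSolver using (solve-∀)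
open import Data.Nat using (suc; _∸_; _<_; z≤n; s≤s)
open import Data.Nat.Properties using (<ᵇ⇒<; <⇒<ᵇ; ≡ᵇ⇒≡; ≡⇒≡ᵇ; m+[n∸m]≡n)
open import Data.Sum using (_⊎_; inj₁; inj₂)
open import Data.Vec using (Vec; []; _∷_)
open import Function.Bundles using (mk⇔; Equivalence)
open import Function.Properties.Equivalence using () renaming (trans to ⇔-trans; sym to ⇔-sym)
open import Relation.Binary.PropositionalEquality using (refl; cong; cong₂; subst; sym; trans; module ≡-Reasoning)
open import Relation.Nullary using (¬_)

nimSum-pairs : ∀ w x y z → nimSum (w ∷ x ∷ y ∷ z ∷ []) ≡ (w ⊕ x) ⊕ (y ⊕ z)
nimSum-pairs w x y z = trans (cong (λ r → w ⊕ (x ⊕ (y ⊕ r))) (⊕-identityʳ z)) (sym (⊕-assoc w x (y ⊕ z)))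

⊕≡0⇔≡ : ∀ {m n} → m ⊕ n ≡ 0 ⇔ m ≡ n
⊕≡0⇔≡ {m} = mk⇔ ⊕≡0⇒≡ λ { refl → ⊕-self m }

square≡barAround : ∀ {m i j} → i < m → j < m →
  bar (+ 1) (+ m) (+ 1) (+ m) ≡ barAround (+ suc i) (+ suc j) (i ∷ m ∸ suc i ∷ j ∷ m ∸ suc j ∷ [])
square≡barAround {m} {i} {j} i<m j<m = sym (begin
  bar (+ suc i - + i) (+ suc i ℤ.+ + (m ∸ suc i)) (+ suc j - + j) (+ suc j ℤ.+ + (m ∸ suc j))
    ≡⟨ cong₂ (λ x y → bar x y (+ suc j - + j) (+ suc j ℤ.+ + (m ∸ suc j))) (lower-edge i) (upper-edge i<m) ⟩
  bar (+ 1) (+ m) (+ suc j - + j) (+ suc j ℤ.+ + (m ∸ suc j))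
    ≡⟨ cong₂ (bar (+ 1) (+ m)) (lower-edge j) (upper-edge j<m) ⟩
  bar (+ 1) (+ m) (+ 1) (+ m)
    ∎)
  where
  open ≡-Reasoning
  [1+x]-x≡1 : ∀ x → (+ 1 ℤ.+ x) - x ≡ + 1
  [1+x]-x≡1 = solve-∀
  lower-edge : ∀ k → + suc k - + k ≡ + 1
  lower-edge k = [1+x]-x≡1 (+ k)
  upper-edge : ∀ {k} → k < m → + suc k ℤ.+ + (m ∸ suc k) ≡ + m
  upper-edge k<m = cong +_ (m+[n∸m]≡n k<m)

PPos-square⇔ : ∀ {m i j} → i < m → j < m →
  PPos (+ suc i) (+ suc j) (bar (+ 1) (+ m) (+ 1) (+ m)) ⇔ rowNimSum m i ≡ rowNimSum m j
PPos-square⇔ {m} {i} {j} i<m j<m =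
  ⇔-trans (subst (λ b → PPos (+ suc i) (+ suc j) b ⇔ nimSum hs ≡ 0) (sym (square≡barAround i<m j<m))
                 (PPos⇔nimSum≡0 (+ suc i) (+ suc j) hs))
          (subst (λ s → s ≡ 0 ⇔ rowNimSum m i ≡ rowNimSum m j)
                 (sym (nimSum-pairs i (m ∸ suc i) j (m ∸ suc j))) ⊕≡0⇔≡)
  where
  hs : Vec ℕ 4
  hs = i ∷ m ∸ suc i ∷ j ∷ m ∸ suc j ∷ []

cell⇔losing : ∀ m i j → (+ suc i , + suc j) ∈P[ m ] ⇔ T (losing m i j)
cell⇔losing m i j = mk⇔ to from
  where
  to : (+ suc i , + suc j) ∈P[ m ] → T (losing m i j)
  to ((_ , +≤+ i<m , _ , +≤+ j<m) , pp) =
    Equivalence.from T-∧ (<⇒<ᵇ i<m , Equivalence.from T-∧ (<⇒<ᵇ j<m ,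
      ≡⇒≡ᵇ _ _ (Equivalence.to (PPos-square⇔ i<m j<m) pp)))
  from : T (losing m i j) → (+ suc i , + suc j) ∈P[ m ]
  from t with Equivalence.to T-∧ t
  ... | i<ᵇm , rest with Equivalence.to T-∧ rest
  ... | j<ᵇm , same = (+≤+ (s≤s z≤n) , +≤+ i<m , +≤+ (s≤s z≤n) , +≤+ j<m) ,
                      Equivalence.from (PPos-square⇔ i<m j<m) (≡ᵇ⇒≡ _ _ same)
    where
    i<m : i < m
    i<m = <ᵇ⇒< i m i<ᵇm
    j<m : j < m
    j<m = <ᵇ⇒< j m j<ᵇm

off-quadrant : ∀ m {i j} → i ≤ + 0 ⊎ j ≤ + 0 → (i , j) ∈P[ m ] ⇔ (a i j m % + 2 ≡ 1)
off-quadrant m {i} {j} outside =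
  mk⇔ (λ ((1≤i , _ , 1≤j , _) , _) → ⊥-elim (not-in-square 1≤i 1≤j outside))
      (λ odd → ⊥-elim (zero-is-even (subst (λ z → z % + 2 ≡ 1) (vanishes outside) odd)))
  where
  not-in-square : + 1 ≤ i → + 1 ≤ j → i ≤ + 0 ⊎ j ≤ + 0 → ⊥
  not-in-square 1≤i _   (inj₁ i≤0) = 1≰0 (≤-trans 1≤i i≤0)
  not-in-square _   1≤j (inj₂ j≤0) = 1≰0 (≤-trans 1≤j j≤0)
  vanishes : i ≤ + 0 ⊎ j ≤ + 0 → a i j m ≡ + 0
  vanishes (inj₁ i≤0) = a-vanishes-left m j i≤0
  vanishes (inj₂ j≤0) = a-vanishes-right m i j≤0
  zero-is-even : ¬ (+ 0 % + 2 ≡ 1)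
  zero-is-even ()

theorem8 : (m : ℕ) → .{{_ : NonZero m}} → (i j : ℤ) →
    ((i , j) ∈P[ m ]) ⇔ (a i j m % + 2 ≡ 1)
theorem8 m (+ suc i) (+ suc j) = ⇔-trans (cell⇔losing m i j) (⇔-sym (NatWithLsb-%2 (a-mod-2-losing m i j)))
theorem8 m (+ 0)     j         = off-quadrant m (inj₁ (+≤+ z≤n))
theorem8 m -[1+ _ ]  j         = off-quadrant m (inj₁ -≤+)
theorem8 m (+ suc _) (+ 0)     = off-quadrant m (inj₂ (+≤+ z≤n))
theorem8 m (+ suc _) -[1+ _ ]  = off-quadrant m (inj₂ -≤+)
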